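{- For every integer $n\geq 3$, the cycle $C_n$ is not matching integral.
   Context: For a graph $G$ on $n$ vertices, let $p(G,r)$ be the number of $r$-matchings (sets of $r$ pairwise non-incident edges), with $p(G,0)=1$. The matching polynomial is $\mu(G,x)=\sum_{r=0}^{\lfloor n/2\rfloor}(-1)^r p(G,r)x^{n-2r}$. A graph is matching integral if all zeros of $\mu(G,x)$ are integers. $C_n$ is the cycle on $n$ vertices. -}

module Defs where

open import Data.Nat as ℕ using (ℕ; zero; suc; _∸_; _≡ᵇ_; _<ᵇ_)
open import Data.Bool using (Bool; true; false; _∧_; _∨_; not; if_then_else_)
open import Data.Fin using (Fin; toℕ)
open import Data.List using (List; []; _∷_; length; filter; map; concatMap; allFin; upTo; foldr)
open import Data.Product using (_×_; _,_)
open import Data.Integer as ℤ using (ℤ; +_; -_)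
open import Relation.Binary.PropositionalEquality using (_≡_)
open import Relation.Nullary using (¬_)
open import Data.Bool using (T)
open import Data.Product using (Σ)

Graph : ℕ → Set
Graph n = Fin n → Fin n → Bool

edges : ∀ {n} → Graph n → List (Fin n × Fin n)
edges {n} G =
  concatMap (λ i → concatMap (λ j →
      if (toℕ i <ᵇ toℕ j) ∧ G i j then (i , j) ∷ [] else []) (allFin n))
    (allFin n)

sublists : {A : Set} → List A → List (List A)
sublists [] = [] ∷ []
sublists (x ∷ xs) = let s = sublists xs in map (x ∷_) s Data.List.++ s

_≡ᶠ_ : ∀ {n} → Fin n → Fin n → Bool
i ≡ᶠ j = toℕ i ≡ᵇ toℕ j

disjoint : ∀ {n} → Fin n × Fin n → Fin n × Fin n → Bool
disjoint (a , b) (c , d) = not ((a ≡ᶠ c) ∨ (a ≡ᶠ d) ∨ (b ≡ᶠ c) ∨ (b ≡ᶠ d))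

isMatching : ∀ {n} → List (Fin n × Fin n) → Bool
isMatching [] = true
isMatching (e ∷ es) = foldr (λ f b → disjoint e f ∧ b) true es ∧ isMatching es

p : ∀ {n} → Graph n → ℕ → ℕ
p G r = length (filter (λ s → T? ((length s ≡ᵇ r) ∧ isMatching s)) (sublists (edges G)))
  where
  open import Relation.Nullary.Decidable using (Dec)
  T? : (b : Bool) → Dec (T b)
  T? = Data.Bool.T?

-- Polynomials with integer coefficients, represented by their coefficient
-- function: k ↦ coefficient of x^k.
Poly : Set
Poly = ℕ → ℤ

sign : ℕ → ℤ
sign zero = + 1
sign (suc r) = - sign r

-- matching polynomial μ(G,x) = Σ_{r=0}^{⌊n/2⌋} (-1)^r p(G,r) x^(n-2r)
μ : ∀ {n} → Graph n → Poly
μ {n} G k = foldr (λ r acc →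
    (if ((2 ℕ.* r) ℕ.≤ᵇ n) ∧ ((n ∸ (2 ℕ.* r)) ≡ᵇ k)
       then sign r ℤ.* (+ p G r) else + 0) ℤ.+ acc)
  (+ 0) (upTo (suc n))

-- finite coefficient lists (ascending powers) and their product
polyAdd : List ℤ → List ℤ → List ℤ
polyAdd [] q = q
polyAdd (a ∷ p') [] = a ∷ p'
polyAdd (a ∷ p') (b ∷ q) = (a ℤ.+ b) ∷ polyAdd p' q

polyMul : List ℤ → List ℤ → List ℤ
polyMul [] q = []
polyMul (c ∷ p') q = polyAdd (map (c ℤ.*_) q) (+ 0 ∷ polyMul p' q)

coeff : List ℤ → Poly
coeff [] k = + 0
coeff (a ∷ _) zero = a
coeff (_ ∷ as) (suc k) = coeff as k

-- ∏_{a ∈ as} (x - a)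
linProd : List ℤ → List ℤ
linProd [] = + 1 ∷ []
linProd (a ∷ as) = polyMul ((- a) ∷ + 1 ∷ []) (linProd as)

-- G is matching integral: all zeros of μ(G,x) are integers, i.e. the monic
-- polynomial μ(G,x) splits as ∏ (x - a_i) with all a_i integers.
MatchingIntegral : ∀ {n} → Graph n → Set
MatchingIntegral G = Σ (List ℤ) (λ as → ∀ k → coeff (linProd as) k ≡ μ G k)

succ? : ∀ {n} → Fin n → Fin n → Bool
succ? {n} i j = (toℕ j ≡ᵇ suc (toℕ i)) ∨ ((toℕ i ≡ᵇ (n ∸ 1)) ∧ (toℕ j ≡ᵇ 0))

cycle : (n : ℕ) → Graph n
cycle n i j = succ? i j ∨ succ? j i

{-# OPTIONS --safe #-}
-- Suppose μ(C_n, x) = ∏ (x − aᵢ) with integers aᵢ.  Comparing coefficients, the elementary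
-- symmetric functions of the roots are e₁ = e₃ = 0, e₂ = −p(C_n,1) = −n and e₄ = p(C_n,2) with
-- 2 e₄ = n(n − 3).  Newton's identities then give Σ aᵢ² = 2n and Σ aᵢ⁴ = 6n, hence
-- Σ (aᵢ² − 1)(aᵢ² − 4) = 0.  Each summand is a non-negative integer vanishing only at |aᵢ| ∈ {1, 2},
-- so if k roots have |aᵢ| = 2 then Σ aᵢ² = n + 3k, i.e. n = 3k, and |μ(C_n, 0)| = |∏ aᵢ| = 2^k.
-- For odd n the constant term μ(C_n, 0) vanishes, but 2^k does not; for even n it is
-- ±p(C_n, n/2) = ±2, so k = 1 and n = 3, which is odd.
module Submission where

open import Defs
open import Data.Nat using (ℕ; _≤_; suc; s≤s; z≤n)
open import Data.Product using (_,_)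
open import Relation.Nullary using (¬_)

module Vieta where
  open import Data.Nat as ℕ using (ℕ; zero; suc; s≤s)
  open import Data.Nat.Properties as ℕ using ()
  open import Data.Integer as ℤ using (ℤ; +_; -_; _+_; _*_; _-_)
  open import Data.Integer.Properties as ℤ using ()
  open import Data.Integer.Tactic.RingSolver using (solve-∀)
  open import Data.List using (List; []; _∷_; length; map; foldr)
  open import Relation.Binary.PropositionalEquality
  open ≡-Reasoning

  ∑ : {A : Set} → List A → (A → ℤ) → ℤ
  ∑ xs f = foldr (λ x s → f x + s) (+ 0) xs

  ∏ : List ℤ → ℤ
  ∏ = foldr _*_ (+ 1)

  coeff-polyAdd : ∀ p q k → coeff (polyAdd p q) k ≡ coeff p k + coeff q k
  coeff-polyAdd []      q       k       = sym (ℤ.+-identityˡ _)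
  coeff-polyAdd (a ∷ p) []      k       = sym (ℤ.+-identityʳ _)
  coeff-polyAdd (a ∷ p) (b ∷ q) zero    = refl
  coeff-polyAdd (a ∷ p) (b ∷ q) (suc k) = coeff-polyAdd p q k

  coeff-map-* : ∀ c q k → coeff (map (c *_) q) k ≡ c * coeff q k
  coeff-map-* c []      k       = sym (ℤ.*-zeroʳ c)
  coeff-map-* c (b ∷ q) zero    = refl
  coeff-map-* c (b ∷ q) (suc k) = coeff-map-* c q k

  coeff-polyMul-linear : ∀ a q k →
    coeff (polyMul (a ∷ + 1 ∷ []) q) k ≡ a * coeff q k + coeff (+ 0 ∷ q) k
  coeff-polyMul-linear a q k = begin
    coeff (polyAdd (map (a *_) q) (+ 0 ∷ polyAdd (map (+ 1 *_) q) (+ 0 ∷ []))) k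
      ≡⟨ coeff-polyAdd (map (a *_) q) _ k ⟩
    coeff (map (a *_) q) k + coeff (+ 0 ∷ polyAdd (map (+ 1 *_) q) (+ 0 ∷ [])) k
      ≡⟨ cong₂ _+_ (coeff-map-* a q k) (shift k) ⟩
    a * coeff q k + coeff (+ 0 ∷ q) k ∎
    where
    shift : ∀ k → coeff (+ 0 ∷ polyAdd (map (+ 1 *_) q) (+ 0 ∷ [])) k ≡ coeff (+ 0 ∷ q) k
    shift zero    = refl
    shift (suc k) = begin
      coeff (polyAdd (map (+ 1 *_) q) (+ 0 ∷ [])) k ≡⟨ coeff-polyAdd (map (+ 1 *_) q) _ k ⟩
      coeff (map (+ 1 *_) q) k + coeff (+ 0 ∷ []) k ≡⟨ cong₂ _+_ (coeff-map-* (+ 1) q k) (zero-poly k) ⟩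
      + 1 * coeff q k + + 0                         ≡⟨ ℤ.+-identityʳ _ ⟩
      + 1 * coeff q k                               ≡⟨ ℤ.*-identityˡ _ ⟩
      coeff q k                                     ∎
      where
      zero-poly : ∀ k → coeff (+ 0 ∷ []) k ≡ + 0
      zero-poly zero    = refl
      zero-poly (suc k) = refl

  coeff-linProd-∷ : ∀ a as k →
    coeff (linProd (a ∷ as)) k ≡ (- a) * coeff (linProd as) k + coeff (+ 0 ∷ linProd as) k
  coeff-linProd-∷ a as = coeff-polyMul-linear (- a) (linProd as)

  esym : List ℤ → ℕ → ℤ
  esym as       zero    = + 1
  esym []       (suc j) = + 0
  esym (a ∷ as) (suc j) = esym as (suc j) + a * esym as j

  esym-vanishes : ∀ as j → length as ℕ.< j → esym as j ≡ + 0
  esym-vanishes []       (suc j) _       = refl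
  esym-vanishes (a ∷ as) (suc j) (s≤s h) = begin
    esym as (suc j) + a * esym as j ≡⟨ cong₂ (λ x y → x + a * y) (esym-vanishes as (suc j) (ℕ.m<n⇒m<1+n h)) (esym-vanishes as j h) ⟩
    + 0 + a * + 0                   ≡⟨ ℤ.+-identityˡ _ ⟩
    a * + 0                         ≡⟨ ℤ.*-zeroʳ a ⟩
    + 0                             ∎

  esym-length : ∀ as → esym as (length as) ≡ ∏ as
  esym-length []       = refl
  esym-length (a ∷ as) = begin
    esym as (suc (length as)) + a * esym as (length as) ≡⟨ cong₂ (λ x y → x + a * y) (esym-vanishes as _ ℕ.≤-refl) (esym-length as) ⟩
    + 0 + a * ∏ as                                      ≡⟨ ℤ.+-identityˡ _ ⟩
    a * ∏ as                                            ∎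

  coeff-linProd-vanishes : ∀ as k → length as ℕ.< k → coeff (linProd as) k ≡ + 0
  coeff-linProd-vanishes []       (suc k) _       = refl
  coeff-linProd-vanishes (a ∷ as) (suc k) (s≤s h) = begin
    coeff (linProd (a ∷ as)) (suc k)                ≡⟨ coeff-linProd-∷ a as (suc k) ⟩
    (- a) * coeff (linProd as) (suc k) + coeff (linProd as) k
      ≡⟨ cong₂ (λ x y → (- a) * x + y) (coeff-linProd-vanishes as (suc k) (ℕ.m<n⇒m<1+n h)) (coeff-linProd-vanishes as k h) ⟩
    (- a) * + 0 + + 0                               ≡⟨ cong (_+ + 0) (ℤ.*-zeroʳ (- a)) ⟩
    + 0                                             ∎

  vieta : ∀ as k j → k ℕ.+ j ≡ length as → coeff (linProd as) k ≡ sign j * esym as j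
  vieta []       zero    zero    _ = refl
  vieta (a ∷ as) zero    (suc j) h = begin
    coeff (linProd (a ∷ as)) 0                         ≡⟨ coeff-linProd-∷ a as 0 ⟩
    (- a) * coeff (linProd as) 0 + + 0                 ≡⟨ cong (λ x → (- a) * x + + 0) (vieta as 0 j (ℕ.suc-injective h)) ⟩
    (- a) * (sign j * esym as j) + + 0                 ≡⟨ rearrange a (sign j) (esym as j) ⟩
    (- sign j) * (+ 0 + a * esym as j)
      ≡⟨ cong (λ x → (- sign j) * (x + a * esym as j)) (esym-vanishes as (suc j) (s≤s (ℕ.≤-reflexive (sym (ℕ.suc-injective h))))) ⟨
    sign (suc j) * esym (a ∷ as) (suc j)               ∎
    where
    rearrange : ∀ a s e → (- a) * (s * e) + + 0 ≡ (- s) * (+ 0 + a * e)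
    rearrange = solve-∀
  vieta (a ∷ as) (suc k) zero    h = begin
    coeff (linProd (a ∷ as)) (suc k)                   ≡⟨ coeff-linProd-∷ a as (suc k) ⟩
    (- a) * coeff (linProd as) (suc k) + coeff (linProd as) k
      ≡⟨ cong₂ (λ x y → (- a) * x + y) (coeff-linProd-vanishes as (suc k) (s≤s (ℕ.≤-reflexive (sym k≡len))))
                                       (vieta as k 0 (trans (ℕ.+-identityʳ k) k≡len)) ⟩
    (- a) * + 0 + + 1 * + 1                            ≡⟨ cong (_+ + 1) (ℤ.*-zeroʳ (- a)) ⟩
    + 1                                                ∎
    where
    k≡len : k ≡ length as
    k≡len = trans (sym (ℕ.+-identityʳ k)) (ℕ.suc-injective h)
  vieta (a ∷ as) (suc k) (suc j) h = begin
    coeff (linProd (a ∷ as)) (suc k)                   ≡⟨ coeff-linProd-∷ a as (suc k) ⟩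
    (- a) * coeff (linProd as) (suc k) + coeff (linProd as) k
      ≡⟨ cong₂ (λ x y → (- a) * x + y) (vieta as (suc k) j (trans (sym (ℕ.+-suc k j)) (ℕ.suc-injective h)))
                                       (vieta as k (suc j) (ℕ.suc-injective h)) ⟩
    (- a) * (sign j * esym as j) + (- sign j) * esym as (suc j)
      ≡⟨ rearrange a (sign j) (esym as j) (esym as (suc j)) ⟩
    (- sign j) * (esym as (suc j) + a * esym as j)     ∎
    where
    rearrange : ∀ a s e e′ → (- a) * (s * e) + (- s) * e′ ≡ (- s) * (e′ + a * e)
    rearrange = solve-∀

  newton₂ : ∀ as → ∑ as (λ a → a * a) ≡ esym as 1 * esym as 1 - + 2 * esym as 2
  newton₂ []       = refl
  newton₂ (a ∷ as) = begin
    a * a + ∑ as (λ a → a * a)                                 ≡⟨ cong (_+_ (a * a)) (newton₂ as) ⟩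
    a * a + (e₁ * e₁ - + 2 * e₂)                               ≡⟨ step a e₁ e₂ ⟩
    (e₁ + a * + 1) * (e₁ + a * + 1) - + 2 * (e₂ + a * e₁)      ∎
    where
    e₁ = esym as 1
    e₂ = esym as 2
    step : ∀ a e₁ e₂ → a * a + (e₁ * e₁ - + 2 * e₂) ≡
           (e₁ + a * + 1) * (e₁ + a * + 1) - + 2 * (e₂ + a * e₁)
    step = solve-∀

  newton₄ : ∀ as → let e = esym as in
    ∑ as (λ a → a * a * (a * a)) ≡
      e 1 * e 1 * e 1 * e 1 - + 4 * e 1 * e 1 * e 2 + + 2 * e 2 * e 2 + + 4 * e 1 * e 3 - + 4 * e 4
  newton₄ []       = refl
  newton₄ (a ∷ as) = trans (cong (_+_ (a * a * (a * a))) (newton₄ as)) (step a (e 1) (e 2) (e 3) (e 4))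
    where
    e = esym as
    step : ∀ a e₁ e₂ e₃ e₄ →
      a * a * (a * a) + (e₁ * e₁ * e₁ * e₁ - + 4 * e₁ * e₁ * e₂ + + 2 * e₂ * e₂ + + 4 * e₁ * e₃ - + 4 * e₄) ≡
      let f₁ = e₁ + a * + 1 ; f₂ = e₂ + a * e₁ ; f₃ = e₃ + a * e₂ ; f₄ = e₄ + a * e₃ in
      f₁ * f₁ * f₁ * f₁ - + 4 * f₁ * f₁ * f₂ + + 2 * f₂ * f₂ + + 4 * f₁ * f₃ - + 4 * f₄
    step = solve-∀

module SmallRoots where
  open Vieta using (∑; ∏)
  open import Data.Nat as ℕ using (ℕ; suc)
  open import Data.Nat.Properties as ℕ using ()
  open import Data.Nat.ListAction using (sum)
  open import Data.Nat.Tactic.RingSolver as ℕ-Solver using ()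
  open import Data.Integer as ℤ using (ℤ; +_; -[1+_]; ∣_∣; _+_; _*_; _-_)
  open import Data.Integer.Properties as ℤ using ()
  open import Data.Integer.Tactic.RingSolver using (solve-∀)
  open import Data.List using (List; []; _∷_; length; map)
  open import Data.List.Relation.Unary.All using (All; []; _∷_)
  open import Data.Product using (∃-syntax; _×_; _,_)
  open import Data.Sum using (_⊎_; inj₁; inj₂)
  open import Function using (_∘_)
  open import Relation.Binary.PropositionalEquality
  open ≡-Reasoning

  SmallRoot : ℤ → Set
  SmallRoot a = ∣ a ∣ ≡ 1 ⊎ ∣ a ∣ ≡ 2

  defect : ℤ → ℤ
  defect a = (a * a - + 1) * (a * a - + 4)

  ∑-defect-powerSums : ∀ as →
    ∑ as defect ≡ ∑ as (λ a → a * a * (a * a)) - + 5 * ∑ as (λ a → a * a) + + 4 * + length as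
  ∑-defect-powerSums []       = refl
  ∑-defect-powerSums (a ∷ as) =
    trans (cong (_+_ (defect a)) (∑-defect-powerSums as))
          (expand a (∑ as (λ a → a * a * (a * a))) (∑ as (λ a → a * a)) (+ length as))
    where
    expand : ∀ a s₄ s₂ l → (a * a - + 1) * (a * a - + 4) + (s₄ - + 5 * s₂ + + 4 * l) ≡
             (a * a * (a * a) + s₄) - + 5 * (a * a + s₂) + + 4 * (+ 1 + l)
    expand = solve-∀

  -- For b = k + 3 this is (b − 2)(b − 1)(b + 1)(b + 2) = (b² − 1)(b² − 4).
  defectᴺ : ℕ → ℕ
  defectᴺ 0                   = 4
  defectᴺ 1                   = 0
  defectᴺ 2                   = 0
  defectᴺ (suc (suc (suc k))) = suc k ℕ.* (2 ℕ.+ k) ℕ.* (4 ℕ.+ k) ℕ.* (5 ℕ.+ k)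

  defectᴺ≡0⇒small : ∀ b → defectᴺ b ≡ 0 → b ≡ 1 ⊎ b ≡ 2
  defectᴺ≡0⇒small 1 _ = inj₁ refl
  defectᴺ≡0⇒small 2 _ = inj₂ refl

  square-abs : ∀ a → a * a ≡ + (∣ a ∣ ℕ.* ∣ a ∣)
  square-abs (+ b)    = sym (ℤ.pos-* b b)
  square-abs -[1+ b ] = refl

  defect-abs : ∀ a → defect a ≡ + defectᴺ ∣ a ∣
  defect-abs a = trans (cong (λ s → (s - + 1) * (s - + 4)) (square-abs a)) (on-squares ∣ a ∣)
    where
    factor : ∀ x → ((+ 3 + x) * (+ 3 + x) - + 1) * ((+ 3 + x) * (+ 3 + x) - + 4) ≡
                   (+ 1 + x) * (+ 2 + x) * (+ 4 + x) * (+ 5 + x)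
    factor = solve-∀
    pos-*₄ : ∀ p q r s → + (p ℕ.* q ℕ.* r ℕ.* s) ≡ + p * + q * + r * + s
    pos-*₄ p q r s = begin
      + (p ℕ.* q ℕ.* r ℕ.* s)   ≡⟨ ℤ.pos-* (p ℕ.* q ℕ.* r) s ⟩
      + (p ℕ.* q ℕ.* r) * + s   ≡⟨ cong (_* + s) (ℤ.pos-* (p ℕ.* q) r) ⟩
      + (p ℕ.* q) * + r * + s   ≡⟨ cong (λ x → x * + r * + s) (ℤ.pos-* p q) ⟩
      + p * + q * + r * + s     ∎
    on-squares : ∀ b → (+ (b ℕ.* b) - + 1) * (+ (b ℕ.* b) - + 4) ≡ + defectᴺ b
    on-squares 0 = refl
    on-squares 1 = refl
    on-squares 2 = refl
    on-squares b@(suc (suc (suc k))) = begin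
      (+ (b ℕ.* b) - + 1) * (+ (b ℕ.* b) - + 4)          ≡⟨ cong (λ s → (s - + 1) * (s - + 4)) (ℤ.pos-* b b) ⟩
      (+ b * + b - + 1) * (+ b * + b - + 4)              ≡⟨ factor (+ k) ⟩
      + suc k * + (2 ℕ.+ k) * + (4 ℕ.+ k) * + (5 ℕ.+ k)  ≡⟨ pos-*₄ (suc k) (2 ℕ.+ k) (4 ℕ.+ k) (5 ℕ.+ k) ⟨
      + defectᴺ b                                        ∎

  ∑-defect-abs : ∀ as → ∑ as defect ≡ + sum (map (defectᴺ ∘ ∣_∣) as)
  ∑-defect-abs []       = refl
  ∑-defect-abs (a ∷ as) = begin
    defect a + ∑ as defect                            ≡⟨ cong₂ _+_ (defect-abs a) (∑-defect-abs as) ⟩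
    + defectᴺ ∣ a ∣ + + sum (map (defectᴺ ∘ ∣_∣) as)  ≡⟨ ℤ.pos-+ (defectᴺ ∣ a ∣) _ ⟨
    + sum (map (defectᴺ ∘ ∣_∣) (a ∷ as))              ∎

  ∑-defect≡0⇒small : ∀ as → ∑ as defect ≡ + 0 → All SmallRoot as
  ∑-defect≡0⇒small as ∑≡0 = all-small as (ℤ.+-injective (trans (sym (∑-defect-abs as)) ∑≡0))
    where
    all-small : ∀ as → sum (map (defectᴺ ∘ ∣_∣) as) ≡ 0 → All SmallRoot as
    all-small []       _   = []
    all-small (a ∷ as) ∑≡0 =
      defectᴺ≡0⇒small ∣ a ∣ (ℕ.m+n≡0⇒m≡0 _ ∑≡0) ∷ all-small as (ℕ.m+n≡0⇒n≡0 (defectᴺ ∣ a ∣) ∑≡0)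

  smallRoots-twos : ∀ {as} → All SmallRoot as →
    ∃[ k ] ∑ as (λ a → a * a) ≡ + (length as ℕ.+ 3 ℕ.* k) × ∣ ∏ as ∣ ≡ 2 ℕ.^ k
  smallRoots-twos                  []               = 0 , refl , refl
  smallRoots-twos {as = a ∷ as} (small ∷ smalls) = step small (smallRoots-twos smalls)
    where
    Twos : List ℤ → Set
    Twos xs = ∃[ k ] ∑ xs (λ a → a * a) ≡ + (length xs ℕ.+ 3 ℕ.* k) × ∣ ∏ xs ∣ ≡ 2 ℕ.^ k
    a²≡ : ∀ {b} → ∣ a ∣ ≡ b → a * a ≡ + (b ℕ.* b)
    a²≡ refl = square-abs a
    ∣a∏∣ : ∀ k → ∣ ∏ as ∣ ≡ 2 ℕ.^ k → ∣ a * ∏ as ∣ ≡ ∣ a ∣ ℕ.* 2 ℕ.^ k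
    ∣a∏∣ k ∣∏∣≡2^k = trans (ℤ.abs-* a (∏ as)) (cong (∣ a ∣ ℕ.*_) ∣∏∣≡2^k)
    count : ∀ l k → 4 ℕ.+ (l ℕ.+ 3 ℕ.* k) ≡ suc l ℕ.+ 3 ℕ.* suc k
    count = ℕ-Solver.solve-∀
    step : SmallRoot a → Twos as → Twos (a ∷ as)
    step (inj₁ ∣a∣≡1) (k , squares , ∣∏∣≡2^k) =
      k , cong₂ _+_ (a²≡ ∣a∣≡1) squares
        , trans (∣a∏∣ k ∣∏∣≡2^k) (trans (cong (ℕ._* 2 ℕ.^ k) ∣a∣≡1) (ℕ.*-identityˡ _))
    step (inj₂ ∣a∣≡2) (k , squares , ∣∏∣≡2^k) =
      suc k , trans (cong₂ _+_ (a²≡ ∣a∣≡2) squares) (cong +_ (count (length as) k))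
            , trans (∣a∏∣ k ∣∏∣≡2^k) (cong (ℕ._* 2 ℕ.^ k) ∣a∣≡2)

module Matchings where
  open import Data.Nat using (ℕ; zero; suc; _+_; _*_; _<_; _≡ᵇ_; z≤n; s≤s)
  open import Data.Nat.Tactic.RingSolver using (solve-∀)
  open import Data.Nat.Properties
    using (_≟_; n<1+n; <-trans; <-irrefl; ≤-trans; ≤-reflexive; m≤m+n; +-suc; +-identityʳ; ≤-refl; ≤-pred; n≤1+n; +-cancelʳ-≡)
  open import Data.Bool using (Bool; true; false; _∧_)
  open import Data.Bool.Properties using (∧-zeroʳ; ∧-comm; ∧-assoc)
  open import Data.List using (List; []; _∷_; _++_; [_]; length; map; filter; foldr)
  open import Data.List.Properties using (length-++; filter-++; filter-all; filter-reject; ++-identityʳ; map-++; map-∘)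
  open import Data.List.Relation.Unary.All using (All; []; _∷_)
  open import Data.Product using (_×_; _,_)
  open import Data.Sum using (_⊎_; inj₁; inj₂; [_,_]′)
  open import Function using (_∘_)
  open import Relation.Binary.PropositionalEquality using (_≡_; _≢_; refl; sym; trans; cong; cong₂; module ≡-Reasoning)
  open import Relation.Nullary using (¬_; Dec; does; ¬?; _⊎-dec_)
  open import Relation.Nullary.Decidable using (T?)

  private
    variable
      A B : Set

  count : (A → Bool) → List A → ℕ
  count Q xs = length (filter (λ x → T? (Q x)) xs)

  count-++ : ∀ (Q : A → Bool) xs ys → count Q (xs ++ ys) ≡ count Q xs + count Q ys
  count-++ Q xs ys = trans (cong length (filter-++ (λ x → T? (Q x)) xs ys)) (length-++ (filter _ xs))

  count-cong : ∀ {Q R : A → Bool} → (∀ x → Q x ≡ R x) → ∀ xs → count Q xs ≡ count R xs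
  count-cong                 Q≗R []       = refl
  count-cong {Q = Q} {R = R} Q≗R (x ∷ xs) with Q x | R x | Q≗R x
  ... | true  | true  | _ = cong suc (count-cong Q≗R xs)
  ... | false | false | _ = count-cong Q≗R xs

  count-none : ∀ {Q : A → Bool} → (∀ x → Q x ≡ false) → ∀ xs → count Q xs ≡ 0
  count-none Q≗false []       = refl
  count-none Q≗false (x ∷ xs) rewrite Q≗false x = count-none Q≗false xs

  count-map : ∀ (Q : B → Bool) (f : A → B) xs → count Q (map f xs) ≡ count (Q ∘ f) xs
  count-map Q f []       = refl
  count-map Q f (x ∷ xs) with Q (f x)
  ... | true  = cong suc (count-map Q f xs)
  ... | false = count-map Q f xs

  count-sublists-∷ : ∀ (Q : List A → Bool) x xs →
    count Q (sublists (x ∷ xs)) ≡ count (Q ∘ (x ∷_)) (sublists xs) + count Q (sublists xs)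
  count-sublists-∷ Q x xs =
    trans (count-++ Q (map (x ∷_) (sublists xs)) (sublists xs))
          (cong (_+ count Q (sublists xs)) (count-map Q (x ∷_) (sublists xs)))

  sublists-map : ∀ (f : A → B) xs → sublists (map f xs) ≡ map (map f) (sublists xs)
  sublists-map f []       = refl
  sublists-map f (x ∷ xs) = begin
    map (f x ∷_) (sublists (map f xs)) ++ sublists (map f xs)
      ≡⟨ cong (λ s → map (f x ∷_) s ++ s) (sublists-map f xs) ⟩
    map (f x ∷_) (map (map f) (sublists xs)) ++ map (map f) (sublists xs)
      ≡⟨ cong (_++ map (map f) (sublists xs)) (trans (sym (map-∘ (sublists xs))) (map-∘ (sublists xs))) ⟩
    map (map f) (map (x ∷_) (sublists xs)) ++ map (map f) (sublists xs)
      ≡⟨ sym (map-++ (map f) (map (x ∷_) (sublists xs)) (sublists xs)) ⟩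
    map (map f) (map (x ∷_) (sublists xs) ++ sublists xs) ∎
    where open ≡-Reasoning

  Edge : Set
  Edge = ℕ × ℕ

  Disjoint : Edge → Edge → Set
  Disjoint (a , b) (c , d) = ¬ (a ≡ c ⊎ a ≡ d ⊎ b ≡ c ⊎ b ≡ d)

  -- does (disjoint? e f) unfolds to the same Boolean as Defs.disjoint on the endpoints' labels.
  disjoint? : ∀ e f → Dec (Disjoint e f)
  disjoint? (a , b) (c , d) = ¬? (a ≟ c ⊎-dec a ≟ d ⊎-dec b ≟ c ⊎-dec b ≟ d)

  disjointFromAll : Edge → List Edge → Bool
  disjointFromAll e = foldr (λ f b → does (disjoint? e f) ∧ b) true

  isMatchingᴺ : List Edge → Bool
  isMatchingᴺ []       = true
  isMatchingᴺ (e ∷ es) = disjointFromAll e es ∧ isMatchingᴺ es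

  isMatchingOfSize : ℕ → List Edge → Bool
  isMatchingOfSize r s = (length s ≡ᵇ r) ∧ isMatchingᴺ s

  matchingCount : List Edge → ℕ → ℕ
  matchingCount es r = count (isMatchingOfSize r) (sublists es)

  dropIncident : Edge → List Edge → List Edge
  dropIncident e = filter (disjoint? e)

  count-disjointFromAll : ∀ (Q : List Edge → Bool) e es →
    count (λ s → Q s ∧ disjointFromAll e s) (sublists es) ≡ count Q (sublists (dropIncident e es))
  count-disjointFromAll Q e [] with Q []
  ... | true  = refl
  ... | false = refl
  count-disjointFromAll Q e (f ∷ es) with does (disjoint? e f) in e∥f
  ... | true  = begin
    count (λ s → Q s ∧ disjointFromAll e s) (sublists (f ∷ es))
      ≡⟨ count-sublists-∷ _ f es ⟩
    count (λ s → Q (f ∷ s) ∧ (does (disjoint? e f) ∧ disjointFromAll e s)) (sublists es)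
      + count (λ s → Q s ∧ disjointFromAll e s) (sublists es)
      ≡⟨ cong₂ _+_ (trans (count-cong (λ s → cong (λ b → Q (f ∷ s) ∧ (b ∧ disjointFromAll e s)) e∥f) (sublists es))
                          (count-disjointFromAll (Q ∘ (f ∷_)) e es))
                   (count-disjointFromAll Q e es) ⟩
    count (Q ∘ (f ∷_)) (sublists (dropIncident e es)) + count Q (sublists (dropIncident e es))
      ≡⟨ count-sublists-∷ Q f (dropIncident e es) ⟨
    count Q (sublists (f ∷ dropIncident e es)) ∎
    where open ≡-Reasoning
  ... | false = trans (count-sublists-∷ _ f es) (cong₂ _+_
    (count-none (λ s → trans (cong (λ b → Q (f ∷ s) ∧ (b ∧ disjointFromAll e s)) e∥f) (∧-zeroʳ (Q (f ∷ s)))) (sublists es))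
    (count-disjointFromAll Q e es))

  matchingCount-zero : ∀ es → matchingCount es 0 ≡ 1
  matchingCount-zero []       = refl
  matchingCount-zero (e ∷ es) = trans (count-sublists-∷ (isMatchingOfSize 0) e es)
    (cong₂ _+_ (count-none (λ _ → refl) (sublists es)) (matchingCount-zero es))

  matchingCount-∷ : ∀ e es r →
    matchingCount (e ∷ es) (suc r) ≡ matchingCount (dropIncident e es) r + matchingCount es (suc r)
  matchingCount-∷ e es r = trans (count-sublists-∷ (isMatchingOfSize (suc r)) e es)
    (cong (_+ matchingCount es (suc r))
      (trans (count-cong (λ s → regroup (length s ≡ᵇ r) (disjointFromAll e s) (isMatchingᴺ s)) (sublists es))
             (count-disjointFromAll (isMatchingOfSize r) e es)))
    where
    regroup : ∀ a b c → a ∧ (b ∧ c) ≡ (a ∧ c) ∧ b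
    regroup a b c = trans (cong (a ∧_) (∧-comm b c)) (sym (∧-assoc a c b))

  pathEdges : ℕ → ℕ → List Edge
  pathEdges b zero    = []
  pathEdges b (suc k) = (b , suc b) ∷ pathEdges (suc b) k

  pathEdges-snoc : ∀ b k → pathEdges b (suc k) ≡ pathEdges b k ++ [ (b + k , suc (b + k)) ]
  pathEdges-snoc b zero    = cong (λ x → [ (x , suc x) ]) (sym (+-identityʳ b))
  pathEdges-snoc b (suc k) = cong ((b , suc b) ∷_)
    (trans (pathEdges-snoc (suc b) k) (cong (λ x → pathEdges (suc b) k ++ [ (x , suc x) ]) (sym (+-suc b k))))

  OffPath : ℕ → ℕ → ℕ → Set
  OffPath b k x = x < b ⊎ b + k < x

  disjoint-pathEdges : ∀ b k {x y} → OffPath b k x → OffPath b k y → All (Disjoint (x , y)) (pathEdges b k)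
  disjoint-pathEdges b zero    _ _ = []
  disjoint-pathEdges b (suc k) x-off y-off =
    [ ≢b x-off , [ ≢sucb x-off , [ ≢b y-off , ≢sucb y-off ]′ ]′ ]′ ∷ disjoint-pathEdges (suc b) k (shift x-off) (shift y-off)
    where
    ≢b : ∀ {x} → OffPath b (suc k) x → x ≢ b
    ≢b (inj₁ x<b)   refl = <-irrefl refl x<b
    ≢b (inj₂ b+k<x) refl = <-irrefl refl (≤-trans (s≤s (m≤m+n b (suc k))) b+k<x)
    ≢sucb : ∀ {x} → OffPath b (suc k) x → x ≢ suc b
    ≢sucb (inj₁ x<b)   refl = <-irrefl refl (<-trans x<b (n<1+n b))
    ≢sucb (inj₂ b+k<x) refl = <-irrefl refl (≤-trans (s≤s (≤-trans (s≤s (m≤m+n b k)) (≤-reflexive (sym (+-suc b k))))) b+k<x)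
    shift : ∀ {x} → OffPath b (suc k) x → OffPath (suc b) k x
    shift (inj₁ x<b)   = inj₁ (<-trans x<b (n<1+n b))
    shift (inj₂ b+k<x) = inj₂ (≤-trans (s≤s (≤-reflexive (sym (+-suc b k)))) b+k<x)

  dropIncident-incident : ∀ e f es → ¬ Disjoint e f → dropIncident e (f ∷ es) ≡ dropIncident e es
  dropIncident-incident e f es = filter-reject (disjoint? e) {f} {es}

  dropIncident-pathEdges : ∀ b k {x y} → OffPath b k x → OffPath b k y → dropIncident (x , y) (pathEdges b k) ≡ pathEdges b k
  dropIncident-pathEdges b k x-off y-off = filter-all (disjoint? _) (disjoint-pathEdges b k x-off y-off)

  pathMatchings : ℕ → ℕ → ℕ
  pathMatchings k             zero    = 1
  pathMatchings zero          (suc r) = 0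
  pathMatchings (suc zero)    (suc r) = pathMatchings zero r
  pathMatchings (suc (suc k)) (suc r) = pathMatchings k r + pathMatchings (suc k) (suc r)

  matchingCount-pathEdges : ∀ k b r → matchingCount (pathEdges b k) r ≡ pathMatchings k r
  matchingCount-pathEdges k             b zero    = matchingCount-zero (pathEdges b k)
  matchingCount-pathEdges zero          b (suc r) = refl
  matchingCount-pathEdges (suc zero)    b (suc r) =
    trans (matchingCount-∷ (b , suc b) [] r) (trans (+-identityʳ _) (matchingCount-pathEdges zero b r))
  matchingCount-pathEdges (suc (suc k)) b (suc r) = begin
    matchingCount (pathEdges b (suc (suc k))) (suc r)
      ≡⟨ matchingCount-∷ (b , suc b) (pathEdges (suc b) (suc k)) r ⟩
    matchingCount (dropIncident (b , suc b) (pathEdges (suc b) (suc k))) r + matchingCount (pathEdges (suc b) (suc k)) (suc r)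
      ≡⟨ cong (λ es → matchingCount es r + matchingCount (pathEdges (suc b) (suc k)) (suc r)) dropped ⟩
    matchingCount (pathEdges (suc (suc b)) k) r + matchingCount (pathEdges (suc b) (suc k)) (suc r)
      ≡⟨ cong₂ _+_ (matchingCount-pathEdges k (suc (suc b)) r) (matchingCount-pathEdges (suc k) (suc b) (suc r)) ⟩
    pathMatchings k r + pathMatchings (suc k) (suc r) ∎
    where
    open ≡-Reasoning
    dropped : dropIncident (b , suc b) (pathEdges (suc b) (suc k)) ≡ pathEdges (suc (suc b)) k
    dropped = trans (dropIncident-incident (b , suc b) (suc b , suc (suc b)) (pathEdges (suc (suc b)) k) (λ d → d (inj₂ (inj₂ (inj₁ refl)))))
                    (dropIncident-pathEdges (suc (suc b)) k (inj₁ (<-trans (n<1+n b) (n<1+n (suc b)))) (inj₁ (n<1+n (suc b))))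

  cycleEdges : ℕ → List Edge
  cycleEdges m = (0 , 1) ∷ (0 , suc (suc m)) ∷ pathEdges 1 (suc m)

  matchingCount-cycleEdges : ∀ m r →
    matchingCount (cycleEdges m) (suc r) ≡ pathMatchings m r + (pathMatchings m r + pathMatchings (suc m) (suc r))
  matchingCount-cycleEdges m r = begin
    matchingCount (cycleEdges m) (suc r)
      ≡⟨ matchingCount-∷ (0 , 1) ((0 , suc (suc m)) ∷ pathEdges 1 (suc m)) r ⟩
    matchingCount (dropIncident (0 , 1) ((0 , suc (suc m)) ∷ pathEdges 1 (suc m))) r
      + matchingCount ((0 , suc (suc m)) ∷ pathEdges 1 (suc m)) (suc r)
      ≡⟨ cong₂ _+_ (cong (λ es → matchingCount es r) drop₀₁) (matchingCount-∷ (0 , suc (suc m)) (pathEdges 1 (suc m)) r) ⟩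
    matchingCount (pathEdges 2 m) r
      + (matchingCount (dropIncident (0 , suc (suc m)) (pathEdges 1 (suc m))) r + matchingCount (pathEdges 1 (suc m)) (suc r))
      ≡⟨ cong (λ es → matchingCount (pathEdges 2 m) r + (matchingCount es r + matchingCount (pathEdges 1 (suc m)) (suc r))) drop₀ₙ ⟩
    matchingCount (pathEdges 2 m) r + (matchingCount (pathEdges 1 m) r + matchingCount (pathEdges 1 (suc m)) (suc r))
      ≡⟨ cong₂ _+_ (matchingCount-pathEdges m 2 r)
                   (cong₂ _+_ (matchingCount-pathEdges m 1 r) (matchingCount-pathEdges (suc m) 1 (suc r))) ⟩
    pathMatchings m r + (pathMatchings m r + pathMatchings (suc m) (suc r)) ∎
    where
    open ≡-Reasoning
    drop₀₁ : dropIncident (0 , 1) ((0 , suc (suc m)) ∷ pathEdges 1 (suc m)) ≡ pathEdges 2 m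
    drop₀₁ = trans (dropIncident-incident (0 , 1) (0 , suc (suc m)) (pathEdges 1 (suc m)) (λ d → d (inj₁ refl)))
             (trans (dropIncident-incident (0 , 1) (1 , 2) (pathEdges 2 m) (λ d → d (inj₂ (inj₂ (inj₁ refl)))))
                    (dropIncident-pathEdges 2 m (inj₁ (s≤s z≤n)) (inj₁ (s≤s (s≤s z≤n)))))
    drop₀ₙ : dropIncident (0 , suc (suc m)) (pathEdges 1 (suc m)) ≡ pathEdges 1 m
    drop₀ₙ = begin
      dropIncident (0 , suc (suc m)) (pathEdges 1 (suc m))
        ≡⟨ cong (dropIncident _) (pathEdges-snoc 1 m) ⟩
      dropIncident (0 , suc (suc m)) (pathEdges 1 m ++ [ (suc m , suc (suc m)) ])
        ≡⟨ filter-++ (disjoint? _) (pathEdges 1 m) _ ⟩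
      dropIncident (0 , suc (suc m)) (pathEdges 1 m) ++ dropIncident (0 , suc (suc m)) [ (suc m , suc (suc m)) ]
        ≡⟨ cong₂ _++_ (dropIncident-pathEdges 1 m (inj₁ (s≤s z≤n)) (inj₂ ≤-refl))
                      (dropIncident-incident (0 , suc (suc m)) (suc m , suc (suc m)) [] (λ d → d (inj₂ (inj₂ (inj₂ refl))))) ⟩
      pathEdges 1 m ++ []
        ≡⟨ ++-identityʳ _ ⟩
      pathEdges 1 m ∎

  pathMatchings-1 : ∀ k → pathMatchings k 1 ≡ k
  pathMatchings-1 zero          = refl
  pathMatchings-1 (suc zero)    = refl
  pathMatchings-1 (suc (suc k)) = cong suc (pathMatchings-1 (suc k))

  pathMatchings-2 : ∀ k → 2 * pathMatchings (suc k) 2 + k ≡ k * k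
  pathMatchings-2 zero    = refl
  pathMatchings-2 (suc k) = begin
    2 * (pathMatchings k 1 + pathMatchings (suc k) 2) + suc k
      ≡⟨ cong (λ x → 2 * (x + pathMatchings (suc k) 2) + suc k) (pathMatchings-1 k) ⟩
    2 * (k + pathMatchings (suc k) 2) + suc k                  ≡⟨ regroup k (pathMatchings (suc k) 2) ⟩
    (2 * pathMatchings (suc k) 2 + k) + 2 * k + 1              ≡⟨ cong (λ x → x + 2 * k + 1) (pathMatchings-2 k) ⟩
    k * k + 2 * k + 1                                          ≡⟨ square-suc k ⟩
    suc k * suc k                                              ∎
    where
    open ≡-Reasoning
    regroup : ∀ k P → 2 * (k + P) + suc k ≡ (2 * P + k) + 2 * k + 1
    regroup = solve-∀
    square-suc : ∀ k → k * k + 2 * k + 1 ≡ suc k * suc k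
    square-suc = solve-∀

  pathMatchings-vanishes : ∀ k r → suc k < r + r → pathMatchings k r ≡ 0
  pathMatchings-vanishes zero          (suc r)       _       = refl
  pathMatchings-vanishes (suc zero)    (suc (suc r)) _       = refl
  pathMatchings-vanishes (suc zero)    (suc zero)    (s≤s (s≤s ()))
  pathMatchings-vanishes (suc (suc k)) (suc r)       (s≤s k+2<2r+1) = cong₂ _+_
    (pathMatchings-vanishes k r (≤-pred (≤-trans k+2<2r+1 (≤-reflexive (+-suc r r)))))
    (pathMatchings-vanishes (suc k) (suc r) (s≤s (≤-trans (n≤1+n _) k+2<2r+1)))

  pathMatchings-overfull : ∀ j → pathMatchings (suc (suc (j + j))) (suc (suc j)) ≡ 0
  pathMatchings-overfull j = pathMatchings-vanishes (suc (suc (j + j))) (suc (suc j)) (too-many j)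
    where
    too-many : ∀ j → suc (suc (suc (j + j))) < suc (suc j) + suc (suc j)
    too-many j rewrite +-suc (suc j) (suc j) | +-suc j j = ≤-refl

  pathMatchings-perfect : ∀ j → pathMatchings (suc (j + j)) (suc j) ≡ 1
  pathMatchings-perfect zero    = refl
  pathMatchings-perfect (suc j) rewrite +-suc j j =
    cong₂ _+_ (pathMatchings-perfect j) (pathMatchings-overfull j)

  matchingCount-cycleEdges-1 : ∀ m → matchingCount (cycleEdges m) 1 ≡ 3 + m
  matchingCount-cycleEdges-1 m = trans (matchingCount-cycleEdges m 0) (cong (λ x → 2 + x) (pathMatchings-1 (suc m)))

  matchingCount-cycleEdges-2 : ∀ m → 2 * matchingCount (cycleEdges m) 2 ≡ m * (3 + m)
  matchingCount-cycleEdges-2 m = +-cancelʳ-≡ m _ _ (begin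
    2 * matchingCount (cycleEdges m) 2 + m
      ≡⟨ cong (λ x → 2 * x + m) (matchingCount-cycleEdges m 1) ⟩
    2 * (pathMatchings m 1 + (pathMatchings m 1 + pathMatchings (suc m) 2)) + m
      ≡⟨ cong (λ x → 2 * (x + (x + pathMatchings (suc m) 2)) + m) (pathMatchings-1 m) ⟩
    2 * (m + (m + pathMatchings (suc m) 2)) + m
      ≡⟨ regroup m (pathMatchings (suc m) 2) ⟩
    4 * m + (2 * pathMatchings (suc m) 2 + m)
      ≡⟨ cong (4 * m +_) (pathMatchings-2 m) ⟩
    4 * m + m * m
      ≡⟨ expand m ⟩
    m * (3 + m) + m ∎)
    where
    open ≡-Reasoning
    regroup : ∀ m P → 2 * (m + (m + P)) + m ≡ 4 * m + (2 * P + m)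
    regroup = solve-∀
    expand : ∀ m → 4 * m + m * m ≡ m * (3 + m) + m
    expand = solve-∀

  matchingCount-cycleEdges-perfect : ∀ j → matchingCount (cycleEdges (suc (j + j))) (suc (suc j)) ≡ 2
  matchingCount-cycleEdges-perfect j = begin
    matchingCount (cycleEdges (suc (j + j))) (suc (suc j))
      ≡⟨ matchingCount-cycleEdges (suc (j + j)) (suc j) ⟩
    pathMatchings (suc (j + j)) (suc j) + (pathMatchings (suc (j + j)) (suc j) + pathMatchings (suc (suc (j + j))) (suc (suc j)))
      ≡⟨ cong₂ (λ x y → x + (x + y)) (pathMatchings-perfect j) (pathMatchings-overfull j) ⟩
    2 ∎
    where open ≡-Reasoning

module Edges where
  open Matchings
  open import Data.Nat using (ℕ; zero; suc; _+_; _∸_; _<_; _≤_; _≡ᵇ_; _<ᵇ_; z≤n; s≤s)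
  open import Data.Nat.Properties
    using (_≟_; _<?_; +-suc; +-identityʳ; <⇒≢; ≤⇒≯; ≮⇒≥; ≤-pred; suc-injective; ≤-refl; ≤-trans; n≤1+n; n<1+n)
  open import Data.Bool using (Bool; true; false; _∧_; _∨_; if_then_else_)
  open import Data.Bool.Properties using (∧-zeroʳ)
  open import Data.Fin using (Fin; toℕ)
  open import Data.List using (List; []; _∷_; _++_; [_]; map; concatMap; upTo; applyUpTo; allFin; tabulate; length; foldr)
  open import Data.List.Properties
    using (map-upTo; concatMap-map; concatMap-++; upTo-∷ʳ; map-concatMap; concatMap-cong; map-tabulate; ++-identityʳ; length-map)
  open import Data.Product using (_×_; _,_)
  open import Function using (_∘_)
  open import Relation.Binary.PropositionalEquality using (_≡_; _≢_; refl; sym; trans; cong; cong₂; module ≡-Reasoning)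
  open import Relation.Nullary using (yes; no)
  open import Relation.Nullary.Decidable using (dec-true; dec-false)

  private
    variable
      A : Set

  ≡ᵇ-refl : ∀ m → (m ≡ᵇ m) ≡ true
  ≡ᵇ-refl m = dec-true (m ≟ m) refl

  ≢⇒≡ᵇ-false : ∀ {m n} → m ≢ n → (m ≡ᵇ n) ≡ false
  ≢⇒≡ᵇ-false {m} {n} = dec-false (m ≟ n)

  <⇒<ᵇ-true : ∀ {m n} → m < n → (m <ᵇ n) ≡ true
  <⇒<ᵇ-true {m} {n} = dec-true (m <? n)

  ≤⇒<ᵇ-false : ∀ {m n} → n ≤ m → (m <ᵇ n) ≡ false
  ≤⇒<ᵇ-false {m} {n} n≤m = dec-false (m <? n) (≤⇒≯ n≤m)

  concatMap-upTo-suc : ∀ (f : ℕ → List A) k → concatMap f (upTo (suc k)) ≡ f 0 ++ concatMap (f ∘ suc) (upTo k)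
  concatMap-upTo-suc f k = cong (f 0 ++_)
    (trans (cong (concatMap f) (sym (map-upTo suc k))) (concatMap-map f suc (upTo k)))

  concatMap-upTo-snoc : ∀ (f : ℕ → List A) k → concatMap f (upTo (suc k)) ≡ concatMap f (upTo k) ++ f k
  concatMap-upTo-snoc f k = begin
    concatMap f (upTo (suc k))          ≡⟨ cong (concatMap f) (upTo-∷ʳ k) ⟨
    concatMap f (upTo k ++ [ k ])       ≡⟨ concatMap-++ f (upTo k) [ k ] ⟩
    concatMap f (upTo k) ++ (f k ++ []) ≡⟨ cong (concatMap f (upTo k) ++_) (++-identityʳ (f k)) ⟩
    concatMap f (upTo k) ++ f k         ∎
    where open ≡-Reasoning

  concatMap-upTo-none : ∀ (f : ℕ → List A) k → (∀ b → b < k → f b ≡ []) → concatMap f (upTo k) ≡ []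
  concatMap-upTo-none f zero    _     = refl
  concatMap-upTo-none f (suc k) empty = trans (concatMap-upTo-suc f k)
    (cong₂ _++_ (empty 0 (s≤s z≤n)) (concatMap-upTo-none (f ∘ suc) k (λ b b<k → empty (suc b) (s≤s b<k))))

  concatMap-upTo-single : ∀ (f : ℕ → List A) k t → t < k → (∀ b → b < k → b ≢ t → f b ≡ []) →
    concatMap f (upTo k) ≡ f t
  concatMap-upTo-single f (suc k) zero    _         empty = trans (concatMap-upTo-suc f k)
    (trans (cong (f 0 ++_) (concatMap-upTo-none (f ∘ suc) k (λ b b<k → empty (suc b) (s≤s b<k) (λ ()))))
           (++-identityʳ (f 0)))
  concatMap-upTo-single f (suc k) (suc t) (s≤s t<k) empty = trans (concatMap-upTo-suc f k)
    (cong₂ _++_ (empty 0 (s≤s z≤n) (λ ()))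
                (concatMap-upTo-single (f ∘ suc) k t t<k (λ b b<k b≢t → empty (suc b) (s≤s b<k) (b≢t ∘ suc-injective))))

  concatMap-upTo-path : ∀ (f : ℕ → List Edge) k b → (∀ a → a < k → f a ≡ [ (b + a , suc (b + a)) ]) →
    concatMap f (upTo k) ≡ pathEdges b k
  concatMap-upTo-path f zero    b _    = refl
  concatMap-upTo-path f (suc k) b step = trans (concatMap-upTo-suc f k)
    (cong₂ _++_ (trans (step 0 (s≤s z≤n)) (cong (λ x → [ (x , suc x) ]) (+-identityʳ b)))
                (concatMap-upTo-path (f ∘ suc) k (suc b)
                   (λ a a<k → trans (step (suc a) (s≤s a<k)) (cong (λ x → [ (x , suc x) ]) (+-suc b a)))))

  toEdge : ∀ {n} → Fin n × Fin n → Edge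
  toEdge (i , j) = (toℕ i , toℕ j)

  isMatching-toEdge : ∀ {n} (es : List (Fin n × Fin n)) → isMatching es ≡ isMatchingᴺ (map toEdge es)
  isMatching-toEdge []       = refl
  isMatching-toEdge (e ∷ es) = cong₂ _∧_ (disjointFromAll-toEdge es) (isMatching-toEdge es)
    where
    disjointFromAll-toEdge : ∀ fs → foldr (λ f b → disjoint e f ∧ b) true fs ≡ disjointFromAll (toEdge e) (map toEdge fs)
    disjointFromAll-toEdge []       = refl
    disjointFromAll-toEdge (f ∷ fs) = cong (disjoint e f ∧_) (disjointFromAll-toEdge fs)

  p≡matchingCount : ∀ {n} (G : Graph n) r → p G r ≡ matchingCount (map toEdge (edges G)) r
  p≡matchingCount G r = begin
    count (λ s → (length s ≡ᵇ r) ∧ isMatching s) (sublists (edges G))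
      ≡⟨ count-cong (λ s → cong₂ (λ l b → (l ≡ᵇ r) ∧ b) (sym (length-map toEdge s)) (isMatching-toEdge s)) (sublists (edges G)) ⟩
    count (isMatchingOfSize r ∘ map toEdge) (sublists (edges G))
      ≡⟨ count-map (isMatchingOfSize r) (map toEdge) (sublists (edges G)) ⟨
    count (isMatchingOfSize r) (map (map toEdge) (sublists (edges G)))
      ≡⟨ cong (count (isMatchingOfSize r)) (sublists-map toEdge (edges G)) ⟨
    matchingCount (map toEdge (edges G)) r ∎
    where open ≡-Reasoning

  tabulate-toℕ : ∀ n → tabulate {n = n} toℕ ≡ upTo n
  tabulate-toℕ zero    = refl
  tabulate-toℕ (suc n) = cong (0 ∷_) (begin
    tabulate (suc ∘ toℕ)       ≡⟨ map-tabulate toℕ suc ⟨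
    map suc (tabulate toℕ)     ≡⟨ cong (map suc) (tabulate-toℕ n) ⟩
    map suc (upTo n)           ≡⟨ map-upTo suc n ⟩
    applyUpTo suc n            ∎)
    where open ≡-Reasoning

  edgeIf : (ℕ → ℕ → Bool) → ℕ → ℕ → List Edge
  edgeIf adj a b = if (a <ᵇ b) ∧ adj a b then [ (a , b) ] else []

  edges-toEdge : ∀ n (adj : ℕ → ℕ → Bool) →
    map toEdge (edges {n} (λ i j → adj (toℕ i) (toℕ j))) ≡ concatMap (λ a → concatMap (edgeIf adj a) (upTo n)) (upTo n)
  edges-toEdge n adj = begin
    map toEdge (concatMap (λ i → concatMap (cell i) (allFin n)) (allFin n))
      ≡⟨ map-concatMap toEdge _ (allFin n) ⟩
    concatMap (λ i → map toEdge (concatMap (cell i) (allFin n))) (allFin n)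
      ≡⟨ concatMap-cong (λ i → row i) (allFin n) ⟩
    concatMap (row-ℕ ∘ toℕ) (allFin n)
      ≡⟨ on-upTo row-ℕ ⟩
    concatMap row-ℕ (upTo n) ∎
    where
    open ≡-Reasoning
    cell : Fin n → Fin n → List (Fin n × Fin n)
    cell i j = if (toℕ i <ᵇ toℕ j) ∧ adj (toℕ i) (toℕ j) then [ (i , j) ] else []
    row-ℕ : ℕ → List Edge
    row-ℕ a = concatMap (edgeIf adj a) (upTo n)
    on-upTo : (f : ℕ → List Edge) → concatMap (f ∘ toℕ) (allFin n) ≡ concatMap f (upTo n)
    on-upTo f = trans (sym (concatMap-map f toℕ (allFin n)))
                      (cong (concatMap f) (trans (map-tabulate (λ i → i) toℕ) (tabulate-toℕ n)))
    map-cell : ∀ i j → map toEdge (cell i j) ≡ edgeIf adj (toℕ i) (toℕ j)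
    map-cell i j with (toℕ i <ᵇ toℕ j) ∧ adj (toℕ i) (toℕ j)
    ... | true  = refl
    ... | false = refl
    row : ∀ i → map toEdge (concatMap (cell i) (allFin n)) ≡ row-ℕ (toℕ i)
    row i = trans (map-concatMap toEdge (cell i) (allFin n))
                  (trans (concatMap-cong (map-cell i) (allFin n)) (on-upTo (edgeIf adj (toℕ i))))

  -- Defs.cycle n i j is definitionally cycleAdj n (toℕ i) (toℕ j).
  cycleAdj : ℕ → ℕ → ℕ → Bool
  cycleAdj n a b = follows a b ∨ follows b a
    where
    follows : ℕ → ℕ → Bool
    follows a b = (b ≡ᵇ suc a) ∨ ((a ≡ᵇ (n ∸ 1)) ∧ (b ≡ᵇ 0))

  module _ (m : ℕ) where
    private
      n = suc (suc (suc m))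
      row : ℕ → List Edge
      row a = concatMap (edgeIf (cycleAdj n) a) (upTo n)

    cycle-row-first : row 0 ≡ (0 , 1) ∷ [ (0 , suc (suc m)) ]
    cycle-row-first = begin
      row 0                                                          ≡⟨ concatMap-upTo-suc (edgeIf (cycleAdj n) 0) (suc (suc m)) ⟩
      concatMap (edgeIf (cycleAdj n) 0 ∘ suc) (upTo (suc (suc m)))   ≡⟨ concatMap-upTo-suc (edgeIf (cycleAdj n) 0 ∘ suc) (suc m) ⟩
      (0 , 1) ∷ concatMap (λ x → edgeIf (cycleAdj n) 0 (suc (suc x))) (upTo (suc m))
        ≡⟨ cong ((0 , 1) ∷_) (concatMap-upTo-single _ (suc m) m ≤-refl back-edge-only) ⟩
      (0 , 1) ∷ edgeIf (cycleAdj n) 0 (suc (suc m))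
        ≡⟨ cong (λ c → (0 , 1) ∷ (if c ∧ true then [ (0 , suc (suc m)) ] else [])) (≡ᵇ-refl m) ⟩
      (0 , 1) ∷ [ (0 , suc (suc m)) ]                                ∎
      where
      open ≡-Reasoning
      back-edge-only : ∀ x → x < suc m → x ≢ m → edgeIf (cycleAdj n) 0 (suc (suc x)) ≡ []
      back-edge-only x _ x≢m rewrite ≢⇒≡ᵇ-false x≢m = refl

    cycle-row-middle : ∀ a → a ≤ m → row (suc a) ≡ [ (suc a , suc (suc a)) ]
    cycle-row-middle a a≤m =
      trans (concatMap-upTo-single _ n (suc (suc a)) (s≤s (s≤s (s≤s a≤m))) off-successor) at-successor
      where
      at-successor : edgeIf (cycleAdj n) (suc a) (suc (suc a)) ≡ [ (suc a , suc (suc a)) ]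
      at-successor rewrite <⇒<ᵇ-true (n<1+n a) | ≡ᵇ-refl a = refl
      off-successor : ∀ b → b < n → b ≢ suc (suc a) → edgeIf (cycleAdj n) (suc a) b ≡ []
      off-successor b _ b≢a+2 with suc a <? b
      off-successor b _ b≢a+2 | no a+1≮b rewrite ≤⇒<ᵇ-false (≮⇒≥ a+1≮b) = refl
      off-successor (suc x) _ b≢a+2 | yes (s≤s a<x)
        rewrite <⇒<ᵇ-true (s≤s a<x) | ≢⇒≡ᵇ-false (b≢a+2 ∘ cong suc) | ≢⇒≡ᵇ-false (<⇒≢ (≤-trans a<x (n≤1+n x)))
              | ∧-zeroʳ (a ≡ᵇ suc m) | ∧-zeroʳ (x ≡ᵇ suc m) = refl

    cycle-row-last : row (suc (suc m)) ≡ []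
    cycle-row-last = concatMap-upTo-none _ n (λ b b<n → cong (λ c → if c ∧ cycleAdj n (suc (suc m)) b then [ (suc (suc m) , b) ] else [])
      (≤⇒<ᵇ-false (≤-pred b<n)))

    edges-cycle : map toEdge (edges (cycle n)) ≡ cycleEdges m
    edges-cycle = begin
      map toEdge (edges (cycle n))                                           ≡⟨ edges-toEdge n (cycleAdj n) ⟩
      concatMap row (upTo n)                                                 ≡⟨ concatMap-upTo-suc row (suc (suc m)) ⟩
      row 0 ++ concatMap (row ∘ suc) (upTo (suc (suc m)))                    ≡⟨ cong (row 0 ++_) (concatMap-upTo-snoc (row ∘ suc) (suc m)) ⟩
      row 0 ++ (concatMap (row ∘ suc) (upTo (suc m)) ++ row (suc (suc m)))
        ≡⟨ cong₂ (λ xs ys → xs ++ (ys ++ row (suc (suc m)))) cycle-row-first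
                 (concatMap-upTo-path (row ∘ suc) (suc m) 1 (λ a a<m+1 → cycle-row-middle a (≤-pred a<m+1))) ⟩
      (0 , 1) ∷ (0 , suc (suc m)) ∷ (pathEdges 1 (suc m) ++ row (suc (suc m)))
        ≡⟨ cong (λ xs → (0 , 1) ∷ (0 , suc (suc m)) ∷ (pathEdges 1 (suc m) ++ xs)) cycle-row-last ⟩
      (0 , 1) ∷ (0 , suc (suc m)) ∷ (pathEdges 1 (suc m) ++ [])
        ≡⟨ cong (λ xs → (0 , 1) ∷ (0 , suc (suc m)) ∷ xs) (++-identityʳ _) ⟩
      cycleEdges m                                                           ∎
      where open ≡-Reasoning

module MatchingPolynomial where
  open Vieta
  open Matchings using (matchingCount-zero)
  open Edges using (toEdge; p≡matchingCount)
  open import Data.Nat as ℕ using (ℕ; zero; suc; _∸_; _≤ᵇ_; _≡ᵇ_; s≤s)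
  open import Data.Nat.Properties as ℕ using ()
  open import Data.Integer as ℤ using (ℤ; +_; -_; ∣_∣; _+_; _*_; _-_)
  open import Data.Integer.Properties as ℤ using ()
  open import Data.Integer.Tactic.RingSolver using (solve-∀)
  open import Data.Bool using (_∧_; if_then_else_)
  open import Data.List using (List; []; _∷_; length; map; upTo)
  open import Data.List.Properties using (map-upTo)
  open import Data.Product using (_,_)
  open import Function using (_∘_)
  open import Relation.Binary.Definitions using (tri<; tri≈; tri>)
  open import Relation.Binary.PropositionalEquality
  open import Relation.Nullary using (yes; no; _×-dec_; contradiction)
  open import Relation.Nullary.Decidable using (dec-true; dec-false)
  open ≡-Reasoning

  ∑-upTo-suc : ∀ (f : ℕ → ℤ) N → ∑ (upTo (suc N)) f ≡ f 0 + ∑ (upTo N) (f ∘ suc)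
  ∑-upTo-suc f N = cong (_+_ (f 0)) (trans (cong (λ xs → ∑ xs f) (sym (map-upTo suc N))) (∑-map (upTo N)))
    where
    ∑-map : ∀ xs → ∑ (map suc xs) f ≡ ∑ xs (f ∘ suc)
    ∑-map []       = refl
    ∑-map (x ∷ xs) = cong (_+_ (f (suc x))) (∑-map xs)

  ∑-zero : ∀ {A : Set} (f : A → ℤ) xs → (∀ x → f x ≡ + 0) → ∑ xs f ≡ + 0
  ∑-zero f []       _      = refl
  ∑-zero f (x ∷ xs) vanish = cong₂ _+_ (vanish x) (∑-zero f xs vanish)

  ∑-upTo-single : ∀ (f : ℕ → ℤ) N i → i ℕ.< N → (∀ j → j ≢ i → f j ≡ + 0) → ∑ (upTo N) f ≡ f i
  ∑-upTo-single f (suc N) zero    _         off = begin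
    ∑ (upTo (suc N)) f         ≡⟨ ∑-upTo-suc f N ⟩
    f 0 + ∑ (upTo N) (f ∘ suc) ≡⟨ cong (_+_ (f 0)) (∑-zero (f ∘ suc) (upTo N) (λ j → off (suc j) λ ())) ⟩
    f 0 + + 0                  ≡⟨ ℤ.+-identityʳ (f 0) ⟩
    f 0                        ∎
  ∑-upTo-single f (suc N) (suc i) (s≤s i<N) off = begin
    ∑ (upTo (suc N)) f         ≡⟨ ∑-upTo-suc f N ⟩
    f 0 + ∑ (upTo N) (f ∘ suc)
      ≡⟨ cong₂ _+_ (off 0 λ ()) (∑-upTo-single (f ∘ suc) N i i<N (λ j j≢i → off (suc j) (j≢i ∘ ℕ.suc-injective))) ⟩
    + 0 + f (suc i)            ≡⟨ ℤ.+-identityˡ (f (suc i)) ⟩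
    f (suc i)                  ∎

  module _ {n} (G : Graph n) (k : ℕ) where

    private
      -- μ G k is definitionally ∑ (upTo (suc n)) term.
      term : ℕ → ℤ
      term r = if ((2 ℕ.* r) ℕ.≤ᵇ n) ∧ ((n ∸ (2 ℕ.* r)) ≡ᵇ k) then sign r * (+ p G r) else + 0

      term-on : ∀ r → k ℕ.+ 2 ℕ.* r ≡ n → term r ≡ sign r * + p G r
      term-on r k+2r≡n = cong (λ b → if b then sign r * + p G r else + 0)
        (dec-true ((2 ℕ.* r ℕ.≤? n) ×-dec (n ∸ 2 ℕ.* r ℕ.≟ k)) (2r≤n , n∸2r≡k))
        where
        2r≤n : 2 ℕ.* r ℕ.≤ n
        2r≤n = subst (2 ℕ.* r ℕ.≤_) k+2r≡n (ℕ.m≤n+m (2 ℕ.* r) k)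
        n∸2r≡k : n ∸ 2 ℕ.* r ≡ k
        n∸2r≡k = trans (cong (_∸ 2 ℕ.* r) (sym k+2r≡n)) (ℕ.m+n∸n≡m k (2 ℕ.* r))

      term-off : ∀ r → k ℕ.+ 2 ℕ.* r ≢ n → term r ≡ + 0
      term-off r k+2r≢n = cong (λ b → if b then sign r * + p G r else + 0)
        (dec-false ((2 ℕ.* r ℕ.≤? n) ×-dec (n ∸ 2 ℕ.* r ℕ.≟ k))
                   (λ (2r≤n , n∸2r≡k) → k+2r≢n (trans (cong (ℕ._+ 2 ℕ.* r) (sym n∸2r≡k)) (ℕ.m∸n+n≡m 2r≤n))))

    μ-coeff : ∀ r → k ℕ.+ 2 ℕ.* r ≡ n → μ G k ≡ sign r * + p G r
    μ-coeff r k+2r≡n = trans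
      (∑-upTo-single term (suc n) r r<1+n (λ r′ r′≢r → term-off r′ (λ k+2r′≡n → r′≢r (unique r′ k+2r′≡n))))
      (term-on r k+2r≡n)
      where
      r<1+n : r ℕ.< suc n
      r<1+n = s≤s (subst (r ℕ.≤_) k+2r≡n (ℕ.≤-trans (ℕ.m≤m+n r (r ℕ.+ 0)) (ℕ.m≤n+m (2 ℕ.* r) k)))
      unique : ∀ r′ → k ℕ.+ 2 ℕ.* r′ ≡ n → r′ ≡ r
      unique r′ k+2r′≡n = ℕ.*-cancelˡ-≡ r′ r 2 (ℕ.+-cancelˡ-≡ k _ _ (trans k+2r′≡n (sym k+2r≡n)))

    μ-coeff-vanishes : (∀ r → k ℕ.+ 2 ℕ.* r ≢ n) → μ G k ≡ + 0
    μ-coeff-vanishes k+2r≢n = ∑-zero term (upTo (suc n)) (λ r → term-off r (k+2r≢n r))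

  sign-involutive : ∀ j x → sign j * (sign j * x) ≡ x
  sign-involutive zero    x = trans (ℤ.*-identityˡ _) (ℤ.*-identityˡ x)
  sign-involutive (suc j) x = trans (negate-twice (sign j) x) (sign-involutive j x)
    where
    negate-twice : ∀ s x → (- s) * ((- s) * x) ≡ s * (s * x)
    negate-twice = solve-∀

  sign-even : ∀ r → sign (2 ℕ.* r) ≡ + 1
  sign-even r = trans (cong (λ j → sign (r ℕ.+ j)) (ℕ.+-identityʳ r)) (sign-double r)
    where
    sign-double : ∀ r → sign (r ℕ.+ r) ≡ + 1
    sign-double zero    = refl
    sign-double (suc r) = begin
      - sign (r ℕ.+ suc r)      ≡⟨ cong (λ j → - sign j) (ℕ.+-suc r r) ⟩
      - - sign (r ℕ.+ r)        ≡⟨ ℤ.neg-involutive _ ⟩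
      sign (r ℕ.+ r)            ≡⟨ sign-double r ⟩
      + 1                       ∎

  ∣sign*∣ : ∀ j x → ∣ sign j * x ∣ ≡ ∣ x ∣
  ∣sign*∣ zero    x = cong ∣_∣ (ℤ.*-identityˡ x)
  ∣sign*∣ (suc j) x = begin
    ∣ - sign j * x ∣      ≡⟨ cong ∣_∣ (ℤ.neg-distribˡ-* (sign j) x) ⟨
    ∣ - (sign j * x) ∣    ≡⟨ ℤ.∣-i∣≡∣i∣ (sign j * x) ⟩
    ∣ sign j * x ∣        ≡⟨ ∣sign*∣ j x ⟩
    ∣ x ∣                 ∎

  p-zero : ∀ {n} (G : Graph n) → p G 0 ≡ 1
  p-zero G = trans (p≡matchingCount G 0) (matchingCount-zero (map toEdge (edges G)))

  MatchingRoots : ∀ {n} → Graph n → List ℤ → Set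
  MatchingRoots G as = ∀ k → coeff (linProd as) k ≡ μ G k

  module _ {n} (G : Graph n) (as : List ℤ) (roots : MatchingRoots G as) where

    matchingRoots-length : length as ≡ n
    matchingRoots-length with ℕ.<-cmp (length as) n
    ... | tri≈ _ len≡n _ = len≡n
    ... | tri< len<n _ _ = contradiction (begin
      + 0                           ≡⟨ coeff-linProd-vanishes as n len<n ⟨
      coeff (linProd as) n          ≡⟨ roots n ⟩
      μ G n                         ≡⟨ μ-coeff G n 0 (ℕ.+-identityʳ n) ⟩
      + 1 * + p G 0                 ≡⟨ cong (λ c → + 1 * + c) (p-zero G) ⟩
      + 1                           ∎) λ ()
    ... | tri> _ _ n<len = contradiction (begin
      + 1                           ≡⟨ vieta as (length as) 0 (ℕ.+-identityʳ _) ⟨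
      coeff (linProd as) (length as) ≡⟨ roots (length as) ⟩
      μ G (length as)
        ≡⟨ μ-coeff-vanishes G (length as) (λ r len+2r≡n → ℕ.<⇒≱ n<len (subst (length as ℕ.≤_) len+2r≡n (ℕ.m≤m+n _ _))) ⟩
      + 0                           ∎) λ ()

    private
      vieta-roots : ∀ k j → k ℕ.+ j ≡ n → μ G k ≡ sign j * esym as j
      vieta-roots k j k+j≡n = trans (sym (roots k)) (vieta as k j (trans k+j≡n (sym matchingRoots-length)))

    matchingRoots-esym-odd : ∀ r → esym as (suc (2 ℕ.* r)) ≡ + 0
    matchingRoots-esym-odd r with suc (2 ℕ.* r) ℕ.≤? n
    ... | no  2r+1≰n = esym-vanishes as _ (subst (ℕ._< suc (2 ℕ.* r)) (sym matchingRoots-length) (ℕ.≰⇒> 2r+1≰n))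
    ... | yes 2r+1≤n = begin
      esym as j                     ≡⟨ sign-involutive j (esym as j) ⟨
      sign j * (sign j * esym as j) ≡⟨ cong (sign j *_) (vieta-roots k j k+j≡n) ⟨
      sign j * μ G k
        ≡⟨ cong (sign j *_) (μ-coeff-vanishes G k (λ r′ k+2r′≡n → ℕ.even≢odd r′ r (ℕ.+-cancelˡ-≡ k _ _ (trans k+2r′≡n (sym k+j≡n))))) ⟩
      sign j * + 0                  ≡⟨ ℤ.*-zeroʳ (sign j) ⟩
      + 0                           ∎
      where
      j = suc (2 ℕ.* r)
      k = n ∸ j
      k+j≡n : k ℕ.+ j ≡ n
      k+j≡n = ℕ.m∸n+n≡m 2r+1≤n

    matchingRoots-esym-even : ∀ r → 2 ℕ.* r ℕ.≤ n → esym as (2 ℕ.* r) ≡ sign r * + p G r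
    matchingRoots-esym-even r 2r≤n = begin
      esym as (2 ℕ.* r)                     ≡⟨ ℤ.*-identityˡ _ ⟨
      + 1 * esym as (2 ℕ.* r)               ≡⟨ cong (_* esym as (2 ℕ.* r)) (sign-even r) ⟨
      sign (2 ℕ.* r) * esym as (2 ℕ.* r)    ≡⟨ vieta-roots (n ∸ 2 ℕ.* r) (2 ℕ.* r) (ℕ.m∸n+n≡m 2r≤n) ⟨
      μ G (n ∸ 2 ℕ.* r)                     ≡⟨ μ-coeff G (n ∸ 2 ℕ.* r) r (ℕ.m∸n+n≡m 2r≤n) ⟩
      sign r * + p G r                      ∎

    matchingRoots-∣∏∣ : ∣ ∏ as ∣ ≡ ∣ μ G 0 ∣
    matchingRoots-∣∏∣ = begin
      ∣ ∏ as ∣                         ≡⟨ ∣sign*∣ n (∏ as) ⟨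
      ∣ sign n * ∏ as ∣                ≡⟨ cong (λ x → ∣ sign n * x ∣) (esym-length as) ⟨
      ∣ sign n * esym as (length as) ∣ ≡⟨ cong (λ j → ∣ sign n * esym as j ∣) matchingRoots-length ⟩
      ∣ sign n * esym as n ∣           ≡⟨ cong ∣_∣ (vieta-roots 0 n refl) ⟨
      ∣ μ G 0 ∣                        ∎

    matchingRoots-∑-squares : ∑ as (λ a → a * a) ≡ - (+ 2 * esym as 2)
    matchingRoots-∑-squares = begin
      ∑ as (λ a → a * a)                                ≡⟨ newton₂ as ⟩
      esym as 1 * esym as 1 - + 2 * esym as 2           ≡⟨ cong (λ e₁ → e₁ * e₁ - + 2 * esym as 2) (matchingRoots-esym-odd 0) ⟩
      + 0 * + 0 - + 2 * esym as 2                       ≡⟨ ℤ.+-identityˡ _ ⟩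
      - (+ 2 * esym as 2)                               ∎

    matchingRoots-∑-fourth-powers : ∑ as (λ a → a * a * (a * a)) ≡ + 2 * esym as 2 * esym as 2 - + 4 * esym as 4
    matchingRoots-∑-fourth-powers = begin
      ∑ as (λ a → a * a * (a * a))
        ≡⟨ newton₄ as ⟩
      e 1 * e 1 * e 1 * e 1 - + 4 * e 1 * e 1 * e 2 + + 2 * e 2 * e 2 + + 4 * e 1 * e 3 - + 4 * e 4
        ≡⟨ cong₂ (λ e₁ e₃ → e₁ * e₁ * e₁ * e₁ - + 4 * e₁ * e₁ * e 2 + + 2 * e 2 * e 2 + + 4 * e₁ * e₃ - + 4 * e 4)
                 (matchingRoots-esym-odd 0) (matchingRoots-esym-odd 1) ⟩
      + 0 * + 0 * + 0 * + 0 - + 4 * + 0 * + 0 * e 2 + + 2 * e 2 * e 2 + + 4 * + 0 * + 0 - + 4 * e 4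
        ≡⟨ drop-odd (e 2) (e 4) ⟩
      + 2 * e 2 * e 2 - + 4 * e 4 ∎
      where
      e = esym as
      drop-odd : ∀ e₂ e₄ → + 0 * + 0 * + 0 * + 0 - + 4 * + 0 * + 0 * e₂ + + 2 * e₂ * e₂ + + 4 * + 0 * + 0 - + 4 * e₄
                           ≡ + 2 * e₂ * e₂ - + 4 * e₄
      drop-odd = solve-∀

module CycleRoots where
  open Vieta
  open SmallRoots
  open Matchings
  open Edges
  open MatchingPolynomial
  open import Data.Nat as ℕ using (ℕ; zero; suc; _≤_; s≤s; z≤n)
  open import Data.Nat.Properties as ℕ using ()
  open import Data.Integer as ℤ using (ℤ; +_; -_; ∣_∣; _+_; _*_; _-_)
  open import Data.Integer.Properties as ℤ using ()
  open import Data.Integer.Tactic.RingSolver using (solve-∀)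
  open import Data.Nat.Tactic.RingSolver as ℕ-Solver using ()
  open import Data.List using (List; length)
  open import Data.List.Relation.Unary.All using (All)
  open import Data.Product using (∃-syntax; _×_; _,_)
  open import Data.Sum using (_⊎_; inj₁; inj₂)
  open import Relation.Binary.PropositionalEquality
  open import Relation.Nullary using (¬_; contradiction)
  open ≡-Reasoning

  even-or-odd : ∀ m → ∃[ j ] (m ≡ j ℕ.+ j ⊎ m ≡ suc (j ℕ.+ j))
  even-or-odd zero    = 0 , inj₁ refl
  even-or-odd (suc m) with even-or-odd m
  ... | j , inj₁ refl = j , inj₂ refl
  ... | j , inj₂ refl = suc j , inj₁ (cong suc (sym (ℕ.+-suc j j)))

  2^k≡2⇒k≡1 : ∀ k → 2 ℕ.^ k ≡ 2 → k ≡ 1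
  2^k≡2⇒k≡1 1             _ = refl
  2^k≡2⇒k≡1 (suc (suc k)) e = contradiction (ℕ.*-cancelˡ-≡ (2 ℕ.* 2 ℕ.^ k) 1 2 e) (ℕ.even≢odd (2 ℕ.^ k) 0)

  p-cycle : ∀ m r → p (cycle (suc (suc (suc m)))) r ≡ matchingCount (cycleEdges m) r
  p-cycle m r = trans (p≡matchingCount (cycle (suc (suc (suc m)))) r) (cong (λ es → matchingCount es r) (edges-cycle m))

  cycleRoots-esym₄ : ∀ m as → MatchingRoots (cycle (suc (suc (suc m)))) as → + 2 * esym as 4 ≡ + (m ℕ.* (3 ℕ.+ m))
  cycleRoots-esym₄ zero    as roots =
    cong (+ 2 *_) (esym-vanishes as 4 (subst (ℕ._< 4) (sym (matchingRoots-length (cycle 3) as roots)) ℕ.≤-refl))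
  cycleRoots-esym₄ (suc m) as roots = begin
    + 2 * esym as 4                      ≡⟨ cong (+ 2 *_) (matchingRoots-esym-even (cycle n) as roots 2 (s≤s (s≤s (s≤s (s≤s z≤n))))) ⟩
    + 2 * (+ 1 * + p (cycle n) 2)        ≡⟨ cong (λ x → + 2 * x) (ℤ.*-identityˡ _) ⟩
    + 2 * + p (cycle n) 2                ≡⟨ ℤ.pos-* 2 (p (cycle n) 2) ⟨
    + (2 ℕ.* p (cycle n) 2)              ≡⟨ cong (λ c → + (2 ℕ.* c)) (p-cycle (suc m) 2) ⟩
    + (2 ℕ.* matchingCount (cycleEdges (suc m)) 2) ≡⟨ cong +_ (matchingCount-cycleEdges-2 (suc m)) ⟩
    + (suc m ℕ.* (3 ℕ.+ suc m))          ∎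
    where n = suc (suc (suc (suc m)))

  module _ (m : ℕ) (as : List ℤ) (roots : MatchingRoots (cycle (suc (suc (suc m)))) as) where

    private
      n = suc (suc (suc m))
      G = cycle n

    cycleRoots-esym₂ : esym as 2 ≡ - + n
    cycleRoots-esym₂ = begin
      esym as 2                  ≡⟨ matchingRoots-esym-even G as roots 1 (s≤s (s≤s z≤n)) ⟩
      - + 1 * + p (cycle n) 1    ≡⟨ ℤ.-1*i≡-i _ ⟩
      - + p (cycle n) 1          ≡⟨ cong (λ c → - + c) (trans (p-cycle m 1) (matchingCount-cycleEdges-1 m)) ⟩
      - + n                      ∎

    cycleRoots-∑-squares : ∑ as (λ a → a * a) ≡ + (n ℕ.+ n)
    cycleRoots-∑-squares = begin
      ∑ as (λ a → a * a)         ≡⟨ matchingRoots-∑-squares G as roots ⟩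
      - (+ 2 * esym as 2)        ≡⟨ cong (λ e₂ → - (+ 2 * e₂)) cycleRoots-esym₂ ⟩
      - (+ 2 * - + n)            ≡⟨ double (+ n) ⟩
      + n + + n                  ∎
      where
      double : ∀ x → - (+ 2 * - x) ≡ x + x
      double = solve-∀

    cycleRoots-∑-defect : ∑ as defect ≡ + 0
    cycleRoots-∑-defect = begin
      ∑ as defect
        ≡⟨ ∑-defect-powerSums as ⟩
      ∑ as (λ a → a * a * (a * a)) - + 5 * ∑ as (λ a → a * a) + + 4 * + length as
        ≡⟨ cong₃ (matchingRoots-∑-fourth-powers G as roots) (matchingRoots-∑-squares G as roots)
                 (cong +_ (matchingRoots-length G as roots)) ⟩
      (+ 2 * esym as 2 * esym as 2 - + 4 * esym as 4) - + 5 * - (+ 2 * esym as 2) + + 4 * + n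
        ≡⟨ cong (λ e₂ → (+ 2 * e₂ * e₂ - + 4 * esym as 4) - + 5 * - (+ 2 * e₂) + + 4 * + n) cycleRoots-esym₂ ⟩
      (+ 2 * - + n * - + n - + 4 * esym as 4) - + 5 * - (+ 2 * - + n) + + 4 * + n
        ≡⟨ collect (+ m) (esym as 4) ⟩
      - + 2 * (+ 2 * esym as 4 - + m * (+ 3 + + m))
        ≡⟨ cong (λ x → - + 2 * (x - + m * (+ 3 + + m))) (trans (cycleRoots-esym₄ m as roots) (ℤ.pos-* m (3 ℕ.+ m))) ⟩
      - + 2 * (+ m * (+ 3 + + m) - + m * (+ 3 + + m))
        ≡⟨ cong (- + 2 *_) (ℤ.+-inverseʳ (+ m * (+ 3 + + m))) ⟩
      + 0 ∎
      where
      cong₃ : ∀ {s₄ t₄ s₂ t₂ l l′} → s₄ ≡ t₄ → s₂ ≡ t₂ → l ≡ l′ →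
              s₄ - + 5 * s₂ + + 4 * l ≡ t₄ - + 5 * t₂ + + 4 * l′
      cong₃ refl refl refl = refl
      collect : ∀ x e₄ → (+ 2 * - (+ 3 + x) * - (+ 3 + x) - + 4 * e₄) - + 5 * - (+ 2 * - (+ 3 + x)) + + 4 * (+ 3 + x)
                         ≡ - + 2 * (+ 2 * e₄ - x * (+ 3 + x))
      collect = solve-∀

    cycleRoots-small : All SmallRoot as
    cycleRoots-small = ∑-defect≡0⇒small as cycleRoots-∑-defect

    cycleRoots-twos : ∃[ k ] n ≡ 3 ℕ.* k × ∣ μ G 0 ∣ ≡ 2 ℕ.^ k
    cycleRoots-twos = from-roots (smallRoots-twos cycleRoots-small)
      where
      from-roots : ∃[ k ] ∑ as (λ a → a * a) ≡ + (length as ℕ.+ 3 ℕ.* k) × ∣ ∏ as ∣ ≡ 2 ℕ.^ k →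
                   ∃[ k ] n ≡ 3 ℕ.* k × ∣ μ G 0 ∣ ≡ 2 ℕ.^ k
      from-roots (k , squares , ∣∏∣≡2^k) = k , n≡3k , trans (sym (matchingRoots-∣∏∣ G as roots)) ∣∏∣≡2^k
        where
        n≡3k : n ≡ 3 ℕ.* k
        n≡3k = ℕ.+-cancelˡ-≡ n _ _ (begin
          n ℕ.+ n                  ≡⟨ ℤ.+-injective (trans (sym cycleRoots-∑-squares) squares) ⟩
          length as ℕ.+ 3 ℕ.* k    ≡⟨ cong (ℕ._+ 3 ℕ.* k) (matchingRoots-length G as roots) ⟩
          n ℕ.+ 3 ℕ.* k            ∎)

  μ₀-cycle-odd : ∀ j → μ (cycle (suc (suc (suc (j ℕ.+ j))))) 0 ≡ + 0
  μ₀-cycle-odd j = μ-coeff-vanishes (cycle _) 0 (λ r 2r≡n → ℕ.even≢odd r (suc j) (trans 2r≡n (odd j)))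
    where
    odd : ∀ j → suc (suc (suc (j ℕ.+ j))) ≡ suc (2 ℕ.* suc j)
    odd = ℕ-Solver.solve-∀

  ∣μ₀∣-cycle-even : ∀ j → ∣ μ (cycle (suc (suc (suc (suc (j ℕ.+ j)))))) 0 ∣ ≡ 2
  ∣μ₀∣-cycle-even j = begin
    ∣ μ (cycle n) 0 ∣                                  ≡⟨ cong ∣_∣ (μ-coeff (cycle n) 0 (suc (suc j)) (even j)) ⟩
    ∣ sign (suc (suc j)) * + p (cycle n) (suc (suc j)) ∣ ≡⟨ ∣sign*∣ (suc (suc j)) _ ⟩
    p (cycle n) (suc (suc j))                          ≡⟨ p-cycle (suc (j ℕ.+ j)) (suc (suc j)) ⟩
    matchingCount (cycleEdges (suc (j ℕ.+ j))) (suc (suc j)) ≡⟨ matchingCount-cycleEdges-perfect j ⟩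
    2                                                  ∎
    where
    n = suc (suc (suc (suc (j ℕ.+ j))))
    even : ∀ j → 2 ℕ.* suc (suc j) ≡ suc (suc (suc (suc (j ℕ.+ j))))
    even = ℕ-Solver.solve-∀

  cycle-not-twos : ∀ m → ¬ (∃[ k ] suc (suc (suc m)) ≡ 3 ℕ.* k × ∣ μ (cycle (suc (suc (suc m)))) 0 ∣ ≡ 2 ℕ.^ k)
  cycle-not-twos m (k , n≡3k , ∣μ₀∣≡2^k) with even-or-odd m
  ... | j , inj₁ m≡2j   = contradiction (ℕ.m^n≡0⇒m≡0 2 k (begin
    2 ℕ.^ k                                ≡⟨ ∣μ₀∣≡2^k ⟨
    ∣ μ (cycle (suc (suc (suc m)))) 0 ∣    ≡⟨ cong (λ m → ∣ μ (cycle (suc (suc (suc m)))) 0 ∣) m≡2j ⟩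
    ∣ μ (cycle (suc (suc (suc (j ℕ.+ j))))) 0 ∣ ≡⟨ cong ∣_∣ (μ₀-cycle-odd j) ⟩
    0                                      ∎)) λ ()
  ... | j , inj₂ m≡2j+1 = contradiction (trans (sym m≡2j+1) m≡0) λ ()
    where
    k≡1 : k ≡ 1
    k≡1 = 2^k≡2⇒k≡1 k (begin
      2 ℕ.^ k                                       ≡⟨ ∣μ₀∣≡2^k ⟨
      ∣ μ (cycle (suc (suc (suc m)))) 0 ∣           ≡⟨ cong (λ m → ∣ μ (cycle (suc (suc (suc m)))) 0 ∣) m≡2j+1 ⟩
      ∣ μ (cycle (suc (suc (suc (suc (j ℕ.+ j)))))) 0 ∣ ≡⟨ ∣μ₀∣-cycle-even j ⟩
      2                                             ∎)
    m≡0 : m ≡ 0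
    m≡0 = ℕ.+-cancelˡ-≡ 3 m 0 (trans n≡3k (cong (3 ℕ.*_) k≡1))

open CycleRoots using (cycle-not-twos; cycleRoots-twos)

lemma3p5 : ∀ (n : ℕ) → 3 ≤ n → ¬ MatchingIntegral (cycle n)
lemma3p5 (suc (suc (suc m))) (s≤s (s≤s (s≤s z≤n))) (as , roots) = cycle-not-twos m (cycleRoots-twos m as roots)
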